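{- Let $p$ be a positive integer and let $G$ be a simple graph of order $p+5$ not containing $B_p$ as a subgraph. If $P$ is a path in $\overline{G}$ and every internal vertex of $P$ has degree $2$ in $\overline{G}$, then the length (number of edges) of $P$ is at most $3$.
   Context: The book $B_p$ is the graph consisting of $p$ triangles sharing a common edge. $\overline{G}$ denotes the complement of $G$. -}

module Defs where

open import Data.Nat using (ℕ; suc; _+_; _<_; _≤_)
open import Data.Fin using (Fin; toℕ; inject₁) renaming (suc to fsuc)
open import Data.Bool using (Bool; true; false; not; _∧_)
open import Data.List using (List; length; filter; allFin)
open import Data.Product using (Σ; _×_; ∃)
open import Function.Definitions using (Injective)
open import Relation.Binary.PropositionalEquality using (_≡_; _≢_)
open import Relation.Nullary using (¬_)
open import Relation.Nullary.Decidable using (does; ¬?)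
open import Data.Fin.Properties using (_≟_)
open import Data.Bool.Properties using (T?)
open import Data.Bool using (T)

record SimpleGraph (n : ℕ) : Set where
  field
    adj   : Fin n → Fin n → Bool
    sym   : ∀ x y → adj x y ≡ adj y x
    irrefl : ∀ x → adj x x ≡ false

open SimpleGraph public

complement : ∀ {n} → SimpleGraph n → SimpleGraph n
complement {n} G = record
  { adj = λ x y → not (does (x ≟ y)) ∧ not (adj G x y)
  ; sym = symC
  ; irrefl = irrC
  }
  where
  open import Relation.Binary.PropositionalEquality using (refl; sym; cong₂; cong)
  open import Relation.Nullary using (yes; no)
  symC : ∀ x y → (not (does (x ≟ y)) ∧ not (adj G x y)) ≡ (not (does (y ≟ x)) ∧ not (adj G y x))
  symC x y with x ≟ y | y ≟ x
  ... | yes _ | yes _ = refl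
  ... | no _ | no _ = cong not (SimpleGraph.sym G x y)
  ... | yes p | no q = Data.Empty.⊥-elim (q (Relation.Binary.PropositionalEquality.sym p))
    where import Data.Empty
  ... | no p | yes q = Data.Empty.⊥-elim (p (Relation.Binary.PropositionalEquality.sym q))
    where import Data.Empty
  irrC : ∀ x → (not (does (x ≟ x)) ∧ not (adj G x x)) ≡ false
  irrC x with x ≟ x
  ... | yes _ = refl
  ... | no ¬p = Data.Empty.⊥-elim (¬p refl)
    where import Data.Empty

Adj : ∀ {n} → SimpleGraph n → Fin n → Fin n → Set
Adj G x y = T (adj G x y)

degree : ∀ {n} → SimpleGraph n → Fin n → ℕ
degree {n} G x = length (filter (λ y → T? (adj G x y)) (allFin n))

-- The book B_p (p triangles sharing a common edge uv) is a subgraph of G: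
-- distinct adjacent u, v, and p pairwise distinct vertices w_i, each
-- different from u and v and adjacent to both.
ContainsBook : ∀ {n} → ℕ → SimpleGraph n → Set
ContainsBook {n} p G =
  Σ (Fin n) λ u → Σ (Fin n) λ v → Σ (Fin p → Fin n) λ w →
    Adj G u v × Injective _≡_ _≡_ w ×
    (∀ i → w i ≢ u × w i ≢ v × Adj G u (w i) × Adj G v (w i))

record Path {n} (G : SimpleGraph n) (k : ℕ) : Set where
  field
    vert     : Fin (suc k) → Fin n
    distinct : Injective _≡_ _≡_ vert
    edges    : ∀ (i : Fin k) → Adj G (vert (inject₁ i)) (vert (fsuc i))

open Path public

InternalDegreesTwo : ∀ {n k} {G : SimpleGraph n} → Path G k → Set
InternalDegreesTwo {k = k} {G = G} P =
  ∀ (i : Fin (suc k)) → 0 < toℕ i → toℕ i < k → degree G (vert P i) ≡ 2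

-- If P had length at least 4, its first five vertices v₀ … v₄ would give a
-- book: in the complement, v₁ and v₃ have degree 2, so their only
-- non-neighbours in G are v₀, v₂ and v₂, v₄ respectively.  Hence v₁v₃ is an
-- edge of G, and each of the p vertices outside {v₀, …, v₄} is adjacent in G
-- to both v₁ and v₃, which is a copy of B_p.
module Submission where

open import Defs hiding (sym)
open import Data.Bool using (T; true; false)
open import Data.Bool.Properties using (T?)
open import Data.Empty using (⊥-elim)
open import Data.Fin using (Fin; zero; suc; #_; inject₁; inject≤; punchIn; punchOut; _↑ˡ_)
open import Data.Fin.Properties
  using (_≟_; 0≢1+n; ↑ˡ-injective; toℕ-↑ˡ; inject≤-injective; suc-injective; punchIn-injective;
         punchInᵢ≢i; punchOut-injective; punchOut-cong; punchOut-punchIn)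
open import Data.List using (List; length; filter)
open import Data.List.Membership.Propositional using (_∈_; lose)
open import Data.List.Membership.Propositional.Properties using (∈-filter⁺; ∈-allFin)
open import Data.List.Properties using (filter-some; filter-notAll)
open import Data.Nat using (ℕ; _+_; _≤_; _<_; z≤n; s≤s)
open import Data.Nat.Properties using (+-comm; ≤-reflexive; ≤-<-trans; <-≤-trans; <-irrefl; m≤m+n)
open import Data.Product using (Σ; _×_; _,_)
open import Data.Sum using (_⊎_; inj₁; inj₂; [_,_])
open import Function using (_∘_)
open import Function.Definitions using (Injective)
open import Relation.Binary.Definitions using (DecidableEquality)
open import Relation.Binary.PropositionalEquality using (_≡_; _≢_; refl; sym; trans; cong; subst)
open import Relation.Nullary using (¬_; yes; no; ¬?; contradiction)
open import Relation.Unary using (Pred; Decidable)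

module _ {a p} {A : Set a} (_≟ᴬ_ : DecidableEquality A) {P : Pred A p} (P? : Decidable P) where

  -- Discarding x, then y, from the list of P-elements shortens it strictly twice.
  distinct³⇒2<length-filter : ∀ {xs x y z} → x ∈ xs → y ∈ xs → z ∈ xs →
                              x ≢ y → x ≢ z → y ≢ z → P x → P y → P z →
                              2 < length (filter P? xs)
  distinct³⇒2<length-filter {xs} {x} {y} {z} x∈ y∈ z∈ x≢y x≢z y≢z px py pz =
    ≤-<-trans (≤-<-trans (filter-some ≢y? (lose z∈S₂ (y≢z ∘ sym)))
                         (filter-notAll ≢y? S₂ (lose y∈S₂ (λ y≢y → y≢y refl))))
              (filter-notAll ≢x? S₁ (lose x∈S₁ (λ x≢x → x≢x refl)))
    where
    ≢x? : Decidable (_≢ x)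
    ≢x? = ¬? ∘ (_≟ᴬ x)
    ≢y? : Decidable (_≢ y)
    ≢y? = ¬? ∘ (_≟ᴬ y)
    S₁ S₂ : List A
    S₁ = filter P? xs
    S₂ = filter ≢x? S₁
    x∈S₁ : x ∈ S₁
    x∈S₁ = ∈-filter⁺ P? x∈ px
    y∈S₂ : y ∈ S₂
    y∈S₂ = ∈-filter⁺ ≢x? (∈-filter⁺ P? y∈ py) (x≢y ∘ sym)
    z∈S₂ : z ∈ S₂
    z∈S₂ = ∈-filter⁺ ≢x? (∈-filter⁺ P? z∈ pz) (x≢z ∘ sym)

adj-sym : ∀ {n} (H : SimpleGraph n) {x y} → Adj H x y → Adj H y x
adj-sym H {x} {y} = subst T (SimpleGraph.sym H x y)

¬adjᶜ⇒adj : ∀ {n} (G : SimpleGraph n) {x y} → x ≢ y → ¬ Adj (complement G) x y → Adj G x y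
¬adjᶜ⇒adj G {x} {y} x≢y ¬xy with x ≟ y | adj G x y
... | yes x≡y | _     = contradiction x≡y x≢y
... | no _    | true  = _
... | no _    | false = ⊥-elim (¬xy _)

degree≡2⇒neighbours : ∀ {n} (H : SimpleGraph n) {v a b x} → degree H v ≡ 2 →
                      Adj H v a → Adj H v b → a ≢ b → Adj H v x → x ≡ a ⊎ x ≡ b
degree≡2⇒neighbours H {v} {a} {b} {x} deg va vb a≢b vx with x ≟ a | x ≟ b
... | yes x≡a | _       = inj₁ x≡a
... | no _    | yes x≡b = inj₂ x≡b
... | no x≢a  | no x≢b  = ⊥-elim (<-irrefl (sym deg) three-neighbours)
  where
  three-neighbours : 2 < degree H v
  three-neighbours = distinct³⇒2<length-filter _≟_ (T? ∘ adj H v)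
    (∈-allFin a) (∈-allFin b) (∈-allFin x) a≢b (x≢a ∘ sym) (x≢b ∘ sym) va vb vx

degree≡2ᶜ⇒adj : ∀ {n} (G : SimpleGraph n) {v a b x} → degree (complement G) v ≡ 2 →
                Adj (complement G) v a → Adj (complement G) v b → a ≢ b →
                x ≢ v → x ≢ a → x ≢ b → Adj G v x
degree≡2ᶜ⇒adj G deg va vb a≢b x≢v x≢a x≢b =
  ¬adjᶜ⇒adj G (x≢v ∘ sym) ([ x≢a , x≢b ] ∘ degree≡2⇒neighbours (complement G) deg va vb a≢b)

Outside : ∀ {k N} → (Fin k → Fin N) → Fin N → Set
Outside a x = ∀ i → x ≢ a i

FreshInjection : ∀ {k N} → (Fin k → Fin N) → ℕ → Set
FreshInjection {N = N} a m = Σ (Fin m → Fin N) λ w → Injective _≡_ _≡_ w × (∀ i → Outside a (w i))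

fresh-injection : ∀ {k m N} (a : Fin k → Fin N) → Injective _≡_ _≡_ a → k + m ≤ N →
                  FreshInjection a m
fresh-injection {ℕ.zero} a _ m≤N = (λ i → inject≤ i m≤N) , inject≤-injective _ _ _ _ , λ _ ()
fresh-injection {ℕ.suc k} {m} {ℕ.suc N} a a-inj (s≤s k+m≤N) =
  punchIn-fresh (fresh-injection a′ a′-inj k+m≤N)
  where
  a₀≢a∘suc : ∀ i → a zero ≢ a (suc i)
  a₀≢a∘suc i = 0≢1+n ∘ a-inj
  a′ : Fin k → Fin N
  a′ i = punchOut (a₀≢a∘suc i)
  a′-inj : Injective _≡_ _≡_ a′
  a′-inj {i} {j} = suc-injective ∘ a-inj ∘ punchOut-injective (a₀≢a∘suc i) (a₀≢a∘suc j)
  punchIn-fresh : FreshInjection a′ m → FreshInjection a m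
  punchIn-fresh (w′ , w′-inj , w′-outside) =
    punchIn (a zero) ∘ w′ , w′-inj ∘ punchIn-injective (a zero) _ _ , w-outside
    where
    w-outside : ∀ i → Outside a (punchIn (a zero) (w′ i))
    w-outside i zero    = punchInᵢ≢i (a zero) _
    w-outside i (suc j) =
      w′-outside i j ∘ trans (sym (punchOut-punchIn (a zero))) ∘ punchOut-cong (a zero)

book-from-outside-neighbours : ∀ {k m N} (G : SimpleGraph N) (a : Fin k → Fin N) →
                               Injective _≡_ _≡_ a → k + m ≤ N → ∀ {i j} → Adj G (a i) (a j) →
                               (∀ x → Outside a x → Adj G (a i) x × Adj G (a j) x) →
                               ContainsBook m G
book-from-outside-neighbours G a a-inj k+m≤N {i} {j} aᵢaⱼ common
  with w , w-inj , w-outside ← fresh-injection a a-inj k+m≤N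
  = a i , a j , w , aᵢaⱼ , w-inj , λ l → w-outside l i , w-outside l j , common (w l) (w-outside l)

inject₁-↑ˡ : ∀ {m} (i : Fin m) n → inject₁ i ↑ˡ n ≡ inject₁ (i ↑ˡ n)
inject₁-↑ˡ zero    n = refl
inject₁-↑ˡ (suc i) n = cong suc (inject₁-↑ˡ i n)

prefix : ∀ {n k} {H : SimpleGraph n} ℓ → Path H (k + ℓ) → Path H k
prefix {H = H} ℓ P = record
  { vert     = vert P ∘ (_↑ˡ ℓ)
  ; distinct = ↑ˡ-injective ℓ _ _ ∘ distinct P
  ; edges    = λ i → subst (λ j → Adj H (vert P j) (vert P (suc (i ↑ˡ ℓ))))
                           (sym (inject₁-↑ˡ i ℓ)) (edges P (i ↑ˡ ℓ))
  }

prefix-internalDegreesTwo : ∀ {n k} {H : SimpleGraph n} ℓ (P : Path H (k + ℓ)) →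
                            InternalDegreesTwo P → InternalDegreesTwo (prefix ℓ P)
prefix-internalDegreesTwo {k = k} ℓ P internal i 0<i i<k =
  internal (i ↑ˡ ℓ) (subst (0 <_) (sym (toℕ-↑ˡ i ℓ)) 0<i)
                    (subst (_< k + ℓ) (sym (toℕ-↑ˡ i ℓ)) (<-≤-trans i<k (m≤m+n k ℓ)))

P₅ᶜ⇒book : ∀ {m} (G : SimpleGraph (m + 5)) (P : Path (complement G) 4) →
           InternalDegreesTwo P → ContainsBook m G
P₅ᶜ⇒book {m} G P internal =
  book-from-outside-neighbours G v (distinct P) (≤-reflexive (+-comm 5 m)) {# 1} {# 3}
    (adj₁ (v≢ λ ()) (v≢ λ ()) (v≢ λ ()))
    λ x out → adj₁ (out (# 1)) (out (# 0)) (out (# 2)) , adj₃ (out (# 3)) (out (# 2)) (out (# 4))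
  where
  v : Fin 5 → Fin (m + 5)
  v = vert P
  v≢ : ∀ {i j} → i ≢ j → v i ≢ v j
  v≢ i≢j = i≢j ∘ distinct P
  adj₁ : ∀ {x} → x ≢ v (# 1) → x ≢ v (# 0) → x ≢ v (# 2) → Adj G (v (# 1)) x
  adj₁ = degree≡2ᶜ⇒adj G (internal (# 1) (s≤s z≤n) (s≤s (s≤s z≤n)))
           (adj-sym (complement G) (edges P (# 0))) (edges P (# 1)) (v≢ λ ())
  adj₃ : ∀ {x} → x ≢ v (# 3) → x ≢ v (# 2) → x ≢ v (# 4) → Adj G (v (# 3)) x
  adj₃ = degree≡2ᶜ⇒adj G (internal (# 3) (s≤s z≤n) (s≤s (s≤s (s≤s (s≤s z≤n)))))
           (adj-sym (complement G) (edges P (# 2))) (edges P (# 3)) (v≢ λ ())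

lemma10 : (p : ℕ) → 1 ≤ p → (G : SimpleGraph (p + 5)) → ¬ ContainsBook p G →
          (k : ℕ) → (P : Path (complement G) k) → InternalDegreesTwo P → k ≤ 3
lemma10 _ _ G noBook (ℕ.suc (ℕ.suc (ℕ.suc (ℕ.suc ℓ)))) P internal =
  contradiction (P₅ᶜ⇒book G (prefix ℓ P) (prefix-internalDegreesTwo ℓ P internal)) noBook
lemma10 _ _ _ _ 0 _ _ = z≤n
lemma10 _ _ _ _ 1 _ _ = s≤s z≤n
lemma10 _ _ _ _ 2 _ _ = s≤s (s≤s z≤n)
lemma10 _ _ _ _ 3 _ _ = s≤s (s≤s (s≤s z≤n))
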